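{- Let $G$ be a connected $r$-regular multigraph that admits an interval coloring. Then $W(G)\leq 1+\left\lfloor \frac{|V(G)|}{2}\right\rfloor(r-1)$.
   Context: Multigraphs are finite and may have multiple edges but no loops. For a positive integer $t$, an interval $t$-coloring of a multigraph $G$ is a proper edge coloring $\alpha:E(G)\to\{1,\dots,t\}$ in which every color $1,\dots,t$ is used and, for every vertex $v$, the set of colors on the edges incident to $v$ is an interval of consecutive integers. For a multigraph $G$ having an interval coloring, $W(G)$ denotes the maximum $t$ such that $G$ has an interval $t$-coloring. -}

module Defs where

open import Data.Nat using (ℕ; zero; suc; _≤_; _<_; _*_; _+_; _∸_; _/_)
open import Data.Fin using (Fin)
open import Data.Fin.Properties using (_≟_)
open import Data.List using (List; length; filter; []; _∷_)
open import Data.List using () renaming (allFin to allFinL)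
open import Data.Product using (Σ; ∃; ∃-syntax; _×_; _,_; proj₁; proj₂)
open import Data.Sum using (_⊎_)
open import Relation.Binary.PropositionalEquality using (_≡_; _≢_)
open import Relation.Nullary using (¬_)
open import Relation.Nullary.Decidable using (_⊎-dec_)

record Multigraph : Set where
  field
    n    : ℕ
    m    : ℕ
    ends : Fin m → Fin n × Fin n
    loopless : ∀ e → proj₁ (ends e) ≢ proj₂ (ends e)

  V = Fin n
  E = Fin m

  Inc : E → V → Set
  Inc e v = (proj₁ (ends e) ≡ v) ⊎ (proj₂ (ends e) ≡ v)

  deg : V → ℕ
  deg v = length (filter (λ e → (proj₁ (ends e) ≟ v) ⊎-dec (proj₂ (ends e) ≟ v)) (allFinL m))

open Multigraph public

Regular : ℕ → Multigraph → Set
Regular r G = ∀ v → deg G v ≡ r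

data Reach (G : Multigraph) : V G → V G → Set where
  here : ∀ {v} → Reach G v v
  step : ∀ {u v w} (e : E G) → Inc G e u → Inc G e v → u ≢ v → Reach G v w → Reach G u w

Connected : Multigraph → Set
Connected G = ∀ u v → Reach G u v

record IsIntervalColoring (G : Multigraph) (t : ℕ) (α : E G → ℕ) : Set where
  field
    range    : ∀ e → 1 ≤ α e × α e ≤ t
    allUsed  : ∀ c → 1 ≤ c → c ≤ t → ∃[ e ] α e ≡ c
    proper   : ∀ e f v → Inc G e v → Inc G f v → α e ≡ α f → e ≡ f
    interval : ∀ v e f c → Inc G e v → Inc G f v → α e ≤ c → c ≤ α f →
               ∃[ g ] (Inc G g v × α g ≡ c)

HasIntervalColoring : Multigraph → Set
HasIntervalColoring G = ∃[ t ] ∃[ α ] IsIntervalColoring G t α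

module Submission where

-- In an interval colouring of an r-regular multigraph the colours at a vertex v form a window
-- [a v, a v + r − 1]. The vertices whose window contains a colour c are the endpoints of the edges
-- of colour c, so there are evenly many; since the colours c, c − r, c − 2r, … meet every window
-- with a v ≤ c exactly once, the number N c of vertices with a v ≤ c is even as well. The a-values
-- of adjacent vertices differ by at most r − 1, so by connectedness N grows from x to x + r − 1,
-- hence by at least 2, for every x between a u = 1 and a w, where w ends an edge of colour
-- t = a w + r − 1. Starting from N 1 ≥ 2 this gives N (a w) ≥ 2 + 2q whenever t > 1 + q (r − 1),
-- which is impossible for q = ⌊|V| / 2⌋.

open import Defs
import Algebra.Properties.Semiring.Sum as Sum
open import Data.Fin using (Fin; zero; suc; toℕ; fromℕ<)
open import Data.Fin.Properties using (_≟_; any?; toℕ-injective; toℕ-fromℕ<)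
import Data.Fin.Properties as Fin
open import Data.List using (length; filter; tabulate)
open import Data.Nat using (ℕ; zero; suc; _≤_; _<_; _+_; _*_; _∸_; _/_; _%_; z≤n; s≤s; _≤?_; _<?_; >-nonZero)
open import Data.Nat.DivMod using (m≡m%n+[m/n]*n; m%n<n)
open import Data.Nat.Divisibility using (_∣_; _∣0; ∣m∣n⇒∣m+n; ∣m+n∣m⇒∣n; m∣m*n; ∣⇒≤)
open import Data.Nat.Properties hiding (_≟_)
import Data.Nat.Properties as ℕ
open import Data.Product using (∃; ∃₂; ∃-syntax; _×_; _,_; proj₁; proj₂)
open import Data.Sum using (_⊎_; inj₁; inj₂; [_,_]′)
open import Data.Empty using (⊥-elim)
open import Function using (_∘_; id)
open import Level using (0ℓ)
open import Relation.Binary.Core using (Rel)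
open import Relation.Binary.Definitions using (Transitive; Total)
open import Relation.Binary.PropositionalEquality
open import Relation.Nullary using (¬_; Dec; yes; no)
open import Relation.Nullary.Decidable using (_⊎-dec_; _×-dec_)
open import Relation.Unary using (Pred; Decidable)

open Sum +-*-semiring
  using (sum; sum-cong-≗; sum-replicate-zero; ∑-comm; ∑-distrib-+; *-distribˡ-sum; *-distribʳ-sum)

𝟙 : ∀ {p} {P : Set p} → Dec P → ℕ
𝟙 (yes _) = 1
𝟙 (no _)  = 0

𝟙-yes : ∀ {P : Set} (P? : Dec P) → P → 𝟙 P? ≡ 1
𝟙-yes (yes _) _ = refl
𝟙-yes (no ¬p) p = ⊥-elim (¬p p)

𝟙-no : ∀ {P : Set} (P? : Dec P) → ¬ P → 𝟙 P? ≡ 0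
𝟙-no (yes p) ¬p = ⊥-elim (¬p p)
𝟙-no (no _)  _  = refl

𝟙-mono : ∀ {P Q : Set} (P? : Dec P) (Q? : Dec Q) → (P → Q) → 𝟙 P? ≤ 𝟙 Q?
𝟙-mono (yes p) Q?      P⇒Q = ≤-reflexive (sym (𝟙-yes Q? (P⇒Q p)))
𝟙-mono (no _)  _       _   = z≤n

𝟙-cong : ∀ {P Q : Set} (P? : Dec P) (Q? : Dec Q) → (P → Q) → (Q → P) → 𝟙 P? ≡ 𝟙 Q?
𝟙-cong P? Q? P⇒Q Q⇒P = ≤-antisym (𝟙-mono P? Q? P⇒Q) (𝟙-mono Q? P? Q⇒P)

𝟙-× : ∀ {P Q : Set} (P? : Dec P) (Q? : Dec Q) → 𝟙 (P? ×-dec Q?) ≡ 𝟙 P? * 𝟙 Q?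
𝟙-× (yes _) (yes _) = refl
𝟙-× (yes _) (no _)  = refl
𝟙-× (no _)  _       = refl

𝟙-⊎ : ∀ {P Q : Set} (P? : Dec P) (Q? : Dec Q) → ¬ (P × Q) → 𝟙 (P? ⊎-dec Q?) ≡ 𝟙 P? + 𝟙 Q?
𝟙-⊎ (yes p) (yes q) ¬pq = ⊥-elim (¬pq (p , q))
𝟙-⊎ (yes _) (no _)  _   = refl
𝟙-⊎ (no _)  (yes _) _   = refl
𝟙-⊎ (no _)  (no _)  _   = refl

∑-mono-≤ : ∀ {n} {f g : Fin n → ℕ} → (∀ i → f i ≤ g i) → sum f ≤ sum g
∑-mono-≤ {zero}  f≤g = z≤n
∑-mono-≤ {suc n} f≤g = +-mono-≤ (f≤g zero) (∑-mono-≤ (f≤g ∘ suc))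

∑-mono-< : ∀ {n} {f g : Fin n → ℕ} → (∀ i → f i ≤ g i) → ∀ j → f j < g j → sum f < sum g
∑-mono-< f≤g zero    fj<gj = +-mono-<-≤ fj<gj (∑-mono-≤ (f≤g ∘ suc))
∑-mono-< f≤g (suc j) fj<gj = +-mono-≤-< (f≤g zero) (∑-mono-< (f≤g ∘ suc) j fj<gj)

0<∑ : ∀ {n} (f : Fin n → ℕ) i → 0 < f i → 0 < sum f
0<∑ {n} f i 0<fi = subst (_< sum f) (sum-replicate-zero n) (∑-mono-< (λ _ → z≤n) i 0<fi)

∑-1 : ∀ n → sum {n} (λ _ → 1) ≡ n
∑-1 zero    = refl
∑-1 (suc n) = cong suc (∑-1 n)

𝟙≤1 : ∀ {P : Set} (P? : Dec P) → 𝟙 P? ≤ 1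
𝟙≤1 (yes _) = ≤-refl
𝟙≤1 (no _)  = z≤n

module _ {n} {P : Pred (Fin n) 0ℓ} (P? : Decidable P) where

  ∑-𝟙-none : (∀ i → ¬ P i) → sum (λ i → 𝟙 (P? i)) ≡ 0
  ∑-𝟙-none ¬P = trans (sum-cong-≗ (λ i → 𝟙-no (P? i) (¬P i))) (sum-replicate-zero n)

  ∑-𝟙-≤ : sum (λ i → 𝟙 (P? i)) ≤ n
  ∑-𝟙-≤ = ≤-trans (∑-mono-≤ (λ i → 𝟙≤1 (P? i))) (≤-reflexive (∑-1 n))

∑-𝟙-unique : ∀ {n} {P : Pred (Fin n) 0ℓ} (P? : Decidable P) {i} → P i → (∀ j → P j → j ≡ i) →
             sum (λ j → 𝟙 (P? j)) ≡ 1
∑-𝟙-unique P? {zero} Pi only =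
  cong₂ _+_ (𝟙-yes (P? zero) Pi) (∑-𝟙-none (P? ∘ suc) (λ j Pj → Fin.0≢1+n (sym (only (suc j) Pj))))
∑-𝟙-unique P? {suc i} Pi only =
  cong₂ _+_ (𝟙-no (P? zero) (Fin.0≢1+n ∘ only zero))
            (∑-𝟙-unique (P? ∘ suc) Pi (λ j → Fin.suc-injective ∘ only (suc j)))

∑-𝟙-window : ∀ {a x} L → a ≤ x → x ≤ a + L → sum {suc L} (λ i → 𝟙 (x ℕ.≟ a + toℕ i)) ≡ 1
∑-𝟙-window {a} {x} L a≤x x≤a+L = ∑-𝟙-unique (λ i → x ℕ.≟ a + toℕ i) x≡a+i only
  where
  x∸a<1+L : x ∸ a < suc L
  x∸a<1+L = s≤s (≤-trans (∸-monoˡ-≤ a x≤a+L) (≤-reflexive (m+n∸m≡n a L)))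
  i = fromℕ< x∸a<1+L
  x≡a+i : x ≡ a + toℕ i
  x≡a+i = trans (sym (m+[n∸m]≡n a≤x)) (cong (a +_) (sym (toℕ-fromℕ< x∸a<1+L)))
  only : ∀ j → x ≡ a + toℕ j → j ≡ i
  only j x≡a+j = toℕ-injective (+-cancelˡ-≡ a _ _ (trans (sym x≡a+j) x≡a+i))

total⇒reflexive : ∀ {R : Rel ℕ 0ℓ} → Total R → ∀ x → R x x
total⇒reflexive total x = [ id , id ]′ (total x x)

extremum : ∀ {n} {P : Pred (Fin n) 0ℓ} {R : Rel ℕ 0ℓ} → Transitive R → Total R →
           Decidable P → (f : Fin n → ℕ) → ∃ P → ∃[ i ] P i × (∀ j → P j → R (f i) (f j))
extremum {suc n} {P} R-trans R-total P? f (i , Pi) with any? (P? ∘ suc)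
... | no ¬P∘suc = zero , P0 i Pi , λ where
        zero    _  → total⇒reflexive R-total (f zero)
        (suc j) Pj → ⊥-elim (¬P∘suc (j , Pj))
  where
  P0 : ∀ i → P i → P zero
  P0 zero    Pi = Pi
  P0 (suc i) Pi = ⊥-elim (¬P∘suc (i , Pi))
... | yes ∃P∘suc with extremum R-trans R-total (P? ∘ suc) (f ∘ suc) ∃P∘suc | P? zero
...   | j , Pj , best | no ¬P0 = suc j , Pj , λ where
        zero    P0 → ⊥-elim (¬P0 P0)
        (suc k) Pk → best k Pk
...   | j , Pj , best | yes P0 with R-total (f zero) (f (suc j))
...     | inj₁ f0Rfj = zero , P0 , λ where
          zero    _  → total⇒reflexive R-total (f zero)
          (suc k) Pk → R-trans f0Rfj (best k Pk)
...     | inj₂ fjRf0 = suc j , Pj , λ where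
          zero    _  → fjRf0
          (suc k) Pk → best k Pk

even-<⇒+2≤ : ∀ {x y} → 2 ∣ x → 2 ∣ y → x < y → x + 2 ≤ y
even-<⇒+2≤ {x} {y} 2∣x 2∣y x<y = begin
  x + 2        ≤⟨ +-monoʳ-≤ x (∣⇒≤ ⦃ >-nonZero (m<n⇒0<n∸m x<y) ⦄ 2∣y∸x) ⟩
  x + (y ∸ x)  ≡⟨ m+[n∸m]≡n (<⇒≤ x<y) ⟩
  y            ∎
  where
  open ≤-Reasoning
  2∣y∸x : 2 ∣ y ∸ x
  2∣y∸x = ∣m+n∣m⇒∣n (subst (2 ∣_) (sym (m+[n∸m]≡n (<⇒≤ x<y))) 2∣y) 2∣x

n<2*[1+n/2] : ∀ n → n < 2 * suc (n / 2)
n<2*[1+n/2] n = begin-strict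
  n                    ≡⟨ m≡m%n+[m/n]*n n 2 ⟩
  n % 2 + (n / 2) * 2  <⟨ +-monoˡ-< ((n / 2) * 2) (m%n<n n 2) ⟩
  2 + (n / 2) * 2      ≡⟨ *-comm (suc (n / 2)) 2 ⟩
  2 * suc (n / 2)      ∎
  where open ≤-Reasoning

infix 4 _∈[_⋯_] _∈[_⋯_]?

_∈[_⋯_] : ℕ → ℕ → ℕ → Set
c ∈[ a ⋯ b ] = a ≤ c × c ≤ b

_∈[_⋯_]? : ∀ c a b → Dec (c ∈[ a ⋯ b ])
c ∈[ a ⋯ b ]? = a ≤? c ×-dec c ≤? b

𝟙-≤-split : ∀ {a} x r' → 𝟙 (a ≤? x + suc r') ≡ 𝟙 (a ≤? x) + 𝟙 (x + suc r' ∈[ a ⋯ a + r' ]?)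
𝟙-≤-split {a} x r' = trans (𝟙-cong (a ≤? y) (a ≤? x ⊎-dec y ∈[ a ⋯ a + r' ]?) split join)
                           (𝟙-⊎ (a ≤? x) (y ∈[ a ⋯ a + r' ]?) disjoint)
  where
  y = x + suc r'
  split : a ≤ y → a ≤ x ⊎ y ∈[ a ⋯ a + r' ]
  split a≤y with a ≤? x
  ... | yes a≤x = inj₁ a≤x
  ... | no  a≰x = inj₂ (a≤y , subst (_≤ a + r') (sym (+-suc x r')) (+-monoˡ-≤ r' (≰⇒> a≰x)))
  join : a ≤ x ⊎ y ∈[ a ⋯ a + r' ] → a ≤ y
  join = [ (λ a≤x → ≤-trans a≤x (m≤m+n x (suc r'))) , proj₁ ]′
  disjoint : ¬ (a ≤ x × y ∈[ a ⋯ a + r' ])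
  disjoint (a≤x , _ , y≤a+r') = <-irrefl refl (<-≤-trans (+-mono-≤-< a≤x (n<1+n r')) y≤a+r')

length-filter-tabulate : ∀ {n} {A : Set} {P : Pred A 0ℓ} (P? : Decidable P) (f : Fin n → A) →
                         length (filter P? (tabulate f)) ≡ sum (λ i → 𝟙 (P? (f i)))
length-filter-tabulate {zero}  P? f = refl
length-filter-tabulate {suc n} P? f with P? (f zero)
... | yes _ = cong suc (length-filter-tabulate P? (f ∘ suc))
... | no _  = length-filter-tabulate P? (f ∘ suc)

module _ (G : Multigraph) where

  incident? : ∀ e v → Dec (Inc G e v)
  incident? e v = (proj₁ (ends G e) ≟ v) ⊎-dec (proj₂ (ends G e) ≟ v)

  deg≡∑ : ∀ v → deg G v ≡ sum (λ e → 𝟙 (incident? e v))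
  deg≡∑ v = length-filter-tabulate (λ e → incident? e v) id

  ∑-endpoints : ∀ e → sum (λ v → 𝟙 (incident? e v)) ≡ 2
  ∑-endpoints e = begin
    sum (λ v → 𝟙 (incident? e v))            ≡⟨ sum-cong-≗ (λ v → 𝟙-⊎ (x ≟ v) (y ≟ v) (x≢y v)) ⟩
    sum (λ v → 𝟙 (x ≟ v) + 𝟙 (y ≟ v))        ≡⟨ ∑-distrib-+ (λ v → 𝟙 (x ≟ v)) (λ v → 𝟙 (y ≟ v)) ⟩
    sum (λ v → 𝟙 (x ≟ v)) + sum (λ v → 𝟙 (y ≟ v))
      ≡⟨ cong₂ _+_ (∑-𝟙-unique (x ≟_) refl (λ _ → sym)) (∑-𝟙-unique (y ≟_) refl (λ _ → sym)) ⟩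
    2                                        ∎
    where
    open ≡-Reasoning
    x = proj₁ (ends G e)
    y = proj₂ (ends G e)
    x≢y : ∀ v → ¬ (x ≡ v × y ≡ v)
    x≢y v (x≡v , y≡v) = loopless G e (trans x≡v (sym y≡v))

  handshake : (w : E G → ℕ) → sum (λ v → sum (λ e → 𝟙 (incident? e v) * w e)) ≡ 2 * sum w
  handshake w = begin
    sum (λ v → sum (λ e → 𝟙 (incident? e v) * w e))  ≡⟨ ∑-comm (λ v e → 𝟙 (incident? e v) * w e) ⟩
    sum (λ e → sum (λ v → 𝟙 (incident? e v) * w e))  ≡⟨ sum-cong-≗ (λ e → sym (*-distribʳ-sum (w e) (λ v → 𝟙 (incident? e v)))) ⟩
    sum (λ e → sum (λ v → 𝟙 (incident? e v)) * w e)  ≡⟨ sum-cong-≗ (λ e → cong (_* w e) (∑-endpoints e)) ⟩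
    sum (λ e → 2 * w e)                               ≡⟨ *-distribˡ-sum 2 w ⟨
    2 * sum w                                         ∎
    where open ≡-Reasoning

  incident⇒deg>0 : ∀ {v e} → Inc G e v → 0 < deg G v
  incident⇒deg>0 {v} {e} e∋v =
    subst (0 <_) (sym (deg≡∑ v)) (0<∑ (λ f → 𝟙 (incident? f v)) e (≤-reflexive (sym (𝟙-yes (incident? e v) e∋v))))

module IntervalColouring {G : Multigraph} {t : ℕ} {α : E G → ℕ} (ic : IsIntervalColoring G t α) where
  open IsIntervalColoring ic

  record Spectrum (v : V G) (a b : ℕ) : Set where
    field
      inside : ∀ {e} → Inc G e v → α e ∈[ a ⋯ b ]
      onto   : ∀ {c} → c ∈[ a ⋯ b ] → ∃[ e ] Inc G e v × α e ≡ c

  spectrum-interval : ∀ {v} → ∃[ e ] Inc G e v → ∃₂ λ a L → Spectrum v a (a + L)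
  spectrum-interval {v} ∃e∋v = α lo , α hi ∸ α lo , subst (Spectrum v (α lo)) (sym (m+[n∸m]≡n (lo-min hi hi∋v))) record
    { inside = λ e∋v → lo-min _ e∋v , hi-max _ e∋v
    ; onto   = λ {c} (lo≤c , c≤hi) → interval v lo hi c lo∋v hi∋v lo≤c c≤hi
    }
    where
    min = extremum ≤-trans ≤-total (λ e → incident? G e v) α ∃e∋v
    max = extremum (λ y≤x z≤y → ≤-trans z≤y y≤x) (λ x y → ≤-total y x) (λ e → incident? G e v) α ∃e∋v
    lo = proj₁ min
    hi = proj₁ max
    lo∋v = proj₁ (proj₂ min)
    hi∋v = proj₁ (proj₂ max)
    lo-min = proj₂ (proj₂ min)
    hi-max = proj₂ (proj₂ max)

  colourCount : V G → ℕ → ℕ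
  colourCount v c = sum (λ e → 𝟙 (incident? G e v) * 𝟙 (α e ℕ.≟ c))

  colourCount≡𝟙× : ∀ v c → colourCount v c ≡ sum (λ e → 𝟙 (incident? G e v ×-dec α e ℕ.≟ c))
  colourCount≡𝟙× v c = sum-cong-≗ (λ e → sym (𝟙-× (incident? G e v) (α e ℕ.≟ c)))

  colourCount≡1 : ∀ {v c e} → Inc G e v → α e ≡ c → colourCount v c ≡ 1
  colourCount≡1 {v} {c} {e} e∋v αe≡c = trans (colourCount≡𝟙× v c)
    (∑-𝟙-unique (λ f → incident? G f v ×-dec α f ℕ.≟ c) (e∋v , αe≡c)
                (λ f (f∋v , αf≡c) → proper f e v f∋v e∋v (trans αf≡c (sym αe≡c))))

  colourCount≡0 : ∀ {v c} → (∀ e → Inc G e v → α e ≢ c) → colourCount v c ≡ 0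
  colourCount≡0 {v} {c} missing = trans (colourCount≡𝟙× v c)
    (∑-𝟙-none (λ f → incident? G f v ×-dec α f ℕ.≟ c) (λ f (f∋v , αf≡c) → missing f f∋v αf≡c))

  colourCount≡𝟙∈ : ∀ {v a b} → Spectrum v a b → ∀ c → colourCount v c ≡ 𝟙 (c ∈[ a ⋯ b ]?)
  colourCount≡𝟙∈ {a = a} {b} S c with c ∈[ a ⋯ b ]?
  ... | yes c∈S = let (e , e∋v , αe≡c) = Spectrum.onto S c∈S in colourCount≡1 e∋v αe≡c
  ... | no  c∉S = colourCount≡0 (λ e e∋v αe≡c → c∉S (subst (_∈[ a ⋯ b ]) αe≡c (Spectrum.inside S e∋v)))

  deg≡1+L : ∀ {v a L} → Spectrum v a (a + L) → deg G v ≡ suc L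
  deg≡1+L {v} {a} {L} S = begin
    deg G v                                                    ≡⟨ deg≡∑ G v ⟩
    sum (λ e → 𝟙 (incident? G e v))                            ≡⟨ sum-cong-≗ coloursInWindow ⟨
    sum (λ e → sum (λ i → 𝟙 (incident? G e v) * colour≡ e i))  ≡⟨ ∑-comm (λ e i → 𝟙 (incident? G e v) * colour≡ e i) ⟩
    sum {suc L} (λ i → colourCount v (a + toℕ i))              ≡⟨ sum-cong-≗ (λ i → everyColourOnce i) ⟩
    sum {suc L} (λ _ → 1)                                      ≡⟨ ∑-1 (suc L) ⟩
    suc L                                                      ∎
    where
    open ≡-Reasoning
    colour≡ : E G → Fin (suc L) → ℕ
    colour≡ e i = 𝟙 (α e ℕ.≟ a + toℕ i)
    coloursInWindow : ∀ e → sum (λ i → 𝟙 (incident? G e v) * colour≡ e i) ≡ 𝟙 (incident? G e v)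
    coloursInWindow e = trans (sym (*-distribˡ-sum (𝟙 (incident? G e v)) (colour≡ e))) (case (incident? G e v))
      where
      case : (e∋v? : Dec (Inc G e v)) → 𝟙 e∋v? * sum (colour≡ e) ≡ 𝟙 e∋v?
      case (yes e∋v) = let (a≤αe , αe≤a+L) = Spectrum.inside S e∋v in trans (*-identityˡ _) (∑-𝟙-window L a≤αe αe≤a+L)
      case (no _)    = refl
    everyColourOnce : ∀ (i : Fin (suc L)) → colourCount v (a + toℕ i) ≡ 1
    everyColourOnce i = let (e , e∋v , αe≡c) = Spectrum.onto S (m≤m+n a (toℕ i) , +-monoʳ-≤ a (≤-pred (Fin.toℕ<n i)))
                        in colourCount≡1 e∋v αe≡c

module RegularIntervalColouring {G : Multigraph} {r' : ℕ} (reg : Regular (suc r') G)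
                                {t : ℕ} {α : E G → ℕ} (ic : IsIntervalColoring G t α) where
  open IntervalColouring ic

  incident-edge : ∀ v → ∃[ e ] Inc G e v
  incident-edge v with any? (λ e → incident? G e v)
  ... | yes ∃e = ∃e
  ... | no  ∄e = ⊥-elim (0≢1+n (begin
    0                                  ≡⟨ ∑-𝟙-none (λ e → incident? G e v) (λ e e∋v → ∄e (e , e∋v)) ⟨
    sum (λ e → 𝟙 (incident? G e v))    ≡⟨ deg≡∑ G v ⟨
    deg G v                            ≡⟨ reg v ⟩
    suc r'                             ∎))
    where open ≡-Reasoning

  spectrum : ∀ v → ∃[ a ] Spectrum v a (a + r')
  spectrum v with spectrum-interval (incident-edge v)
  ... | a , L , S = a , subst (λ L → Spectrum v a (a + L)) (suc-injective (trans (sym (deg≡1+L S)) (reg v))) S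

  lowest : V G → ℕ
  lowest v = proj₁ (spectrum v)

  lowest≤ : ∀ {v e} → Inc G e v → lowest v ≤ α e
  lowest≤ {v} = proj₁ ∘ Spectrum.inside (proj₂ (spectrum v))

  ≤lowest+r' : ∀ {v e} → Inc G e v → α e ≤ lowest v + r'
  ≤lowest+r' {v} = proj₂ ∘ Spectrum.inside (proj₂ (spectrum v))

  adjacent-lowest : ∀ {e x y} → Inc G e x → Inc G e y → lowest x ≤ lowest y + r'
  adjacent-lowest e∋x e∋y = ≤-trans (lowest≤ e∋x) (≤lowest+r' e∋y)

  #window : ℕ → ℕ
  #window c = sum (λ v → 𝟙 (c ∈[ lowest v ⋯ lowest v + r' ]?))

  #window-even : ∀ c → 2 ∣ #window c
  #window-even c = subst (2 ∣_) (sym #window≡) (m∣m*n (sum (λ e → 𝟙 (α e ℕ.≟ c))))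
    where
    open ≡-Reasoning
    #window≡ : #window c ≡ 2 * sum (λ e → 𝟙 (α e ℕ.≟ c))
    #window≡ = begin
      #window c                       ≡⟨ sum-cong-≗ (λ v → colourCount≡𝟙∈ (proj₂ (spectrum v)) c) ⟨
      sum (λ v → colourCount v c)     ≡⟨ handshake G (λ e → 𝟙 (α e ℕ.≟ c)) ⟩
      2 * sum (λ e → 𝟙 (α e ℕ.≟ c))   ∎

  #lowest≤ : ℕ → ℕ
  #lowest≤ c = sum (λ v → 𝟙 (lowest v ≤? c))

  #lowest≤-base : ∀ {s} → s ≤ r' → #lowest≤ s ≡ #window s
  #lowest≤-base {s} s≤r' = sum-cong-≗ λ v →
    𝟙-cong (lowest v ≤? s) (s ∈[ lowest v ⋯ lowest v + r' ]?) (_, ≤-trans s≤r' (m≤n+m r' (lowest v))) proj₁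

  #lowest≤-step : ∀ x → #lowest≤ (x + suc r') ≡ #lowest≤ x + #window (x + suc r')
  #lowest≤-step x = trans (sum-cong-≗ (λ v → 𝟙-≤-split {lowest v} x r'))
    (∑-distrib-+ (λ v → 𝟙 (lowest v ≤? x)) (λ v → 𝟙 (x + suc r' ∈[ lowest v ⋯ lowest v + r' ]?)))

  #lowest≤-even : ∀ c → 2 ∣ #lowest≤ c
  #lowest≤-even c = subst (λ x → 2 ∣ #lowest≤ x) (sym (m≡m%n+[m/n]*n c (suc r')))
                          (periodic (c / suc r') (≤-pred (m%n<n c (suc r'))))
    where
    periodic : ∀ k {s} → s ≤ r' → 2 ∣ #lowest≤ (s + k * suc r')
    periodic zero    {s} s≤r' = subst (λ x → 2 ∣ #lowest≤ x) (sym (+-identityʳ s))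
                                      (subst (2 ∣_) (sym (#lowest≤-base s≤r')) (#window-even s))
    periodic (suc k) {s} s≤r' = subst (λ x → 2 ∣ #lowest≤ x) shift
                                      (subst (2 ∣_) (sym (#lowest≤-step x)) (∣m∣n⇒∣m+n (periodic k s≤r') (#window-even _)))
      where
      x = s + k * suc r'
      shift : x + suc r' ≡ s + suc k * suc r'
      shift = trans (+-assoc s (k * suc r') (suc r')) (cong (s +_) (+-comm (k * suc r') (suc r')))

  #lowest≤-≤n : ∀ c → #lowest≤ c ≤ n G
  #lowest≤-≤n c = ∑-𝟙-≤ (λ v → lowest v ≤? c)

  #lowest≤-mono-< : ∀ {x y} v → x < lowest v → lowest v ≤ y → #lowest≤ x < #lowest≤ y
  #lowest≤-mono-< {x} {y} v x<v v≤y =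
    ∑-mono-< (λ v′ → 𝟙-mono (lowest v′ ≤? x) (lowest v′ ≤? y) (λ v′≤x → ≤-trans v′≤x x≤y)) v
             (subst₂ _<_ (sym (𝟙-no (lowest v ≤? x) (<⇒≱ x<v))) (sym (𝟙-yes (lowest v ≤? y) v≤y)) ≤-refl)
    where
    x≤y = ≤-trans (<⇒≤ x<v) v≤y

  2≤#lowest≤ : ∀ {c} v → lowest v ≤ c → 2 ≤ #lowest≤ c
  2≤#lowest≤ {c} v v≤c =
    even-<⇒+2≤ (2 ∣0) (#lowest≤-even c) (0<∑ (λ v → 𝟙 (lowest v ≤? c)) v (≤-reflexive (sym (𝟙-yes (lowest v ≤? c) v≤c))))

  sublevel-closed : ∀ {x} → (∀ v → lowest v ≤ x + r' → lowest v ≤ x) →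
                    ∀ {p q} → Reach G p q → lowest p ≤ x → lowest q ≤ x
  sublevel-closed gapless here p≤x = p≤x
  sublevel-closed gapless (step e e∋p e∋p′ _ p′⇝q) p≤x =
    sublevel-closed gapless p′⇝q (gapless _ (≤-trans (adjacent-lowest e∋p′ e∋p) (+-monoˡ-≤ r' p≤x)))

  #lowest≤-jump : ∀ {u w x} → Reach G u w → lowest u ≤ x → x < lowest w → #lowest≤ x + 2 ≤ #lowest≤ (x + r')
  #lowest≤-jump {u} {w} {x} u⇝w u≤x x<w = even-<⇒+2≤ (#lowest≤-even x) (#lowest≤-even (x + r')) increases
    where
    increases : #lowest≤ x < #lowest≤ (x + r')
    increases with #lowest≤ x <? #lowest≤ (x + r')
    ... | yes inc = inc
    ... | no  ¬inc = ⊥-elim (<⇒≱ x<w (sublevel-closed gapless u⇝w u≤x))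
      where
      gapless : ∀ v → lowest v ≤ x + r' → lowest v ≤ x
      gapless v v≤x+r' with lowest v ≤? x
      ... | yes v≤x = v≤x
      ... | no  v≰x = ⊥-elim (¬inc (#lowest≤-mono-< v (≰⇒> v≰x) v≤x+r'))

  module _ {u w} (u⇝w : Reach G u w) (u≤1 : lowest u ≤ 1) where

    #lowest≤-growth : ∀ k → 1 + k * r' < lowest w → 2 * suc k ≤ #lowest≤ (1 + k * r')
    #lowest≤-growth zero    _   = 2≤#lowest≤ u u≤1
    #lowest≤-growth (suc k) x<w = begin
      2 * suc (suc k)               ≡⟨ *-suc 2 (suc k) ⟩
      2 + 2 * suc k                 ≤⟨ +-monoʳ-≤ 2 (#lowest≤-growth k x′<w) ⟩
      2 + #lowest≤ x′               ≡⟨ +-comm 2 (#lowest≤ x′) ⟩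
      #lowest≤ x′ + 2               ≤⟨ #lowest≤-jump u⇝w (≤-trans u≤1 (s≤s z≤n)) x′<w ⟩
      #lowest≤ (x′ + r')            ≡⟨ cong (#lowest≤ ∘ suc) (+-comm (k * r') r') ⟩
      #lowest≤ (1 + suc k * r')     ∎
      where
      open ≤-Reasoning
      x′ = 1 + k * r'
      x′<w : x′ < lowest w
      x′<w = ≤-<-trans (s≤s (m≤n+m (k * r') r')) x<w

    #lowest≤-top : ∀ q → 1 + q * r' < lowest w + r' → 2 * suc q ≤ #lowest≤ (lowest w)
    #lowest≤-top zero    _ = 2≤#lowest≤ w ≤-refl
    #lowest≤-top (suc k) x+r'<w+r' = begin
      2 * suc (suc k)               ≡⟨ *-suc 2 (suc k) ⟩
      2 + 2 * suc k                 ≤⟨ +-monoʳ-≤ 2 (#lowest≤-growth k x<w) ⟩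
      2 + #lowest≤ x                ≡⟨ +-comm 2 (#lowest≤ x) ⟩
      #lowest≤ x + 2                ≤⟨ even-<⇒+2≤ (#lowest≤-even x) (#lowest≤-even (lowest w)) (#lowest≤-mono-< w x<w ≤-refl) ⟩
      #lowest≤ (lowest w)           ∎
      where
      open ≤-Reasoning
      x = 1 + k * r'
      x<w : x < lowest w
      x<w = +-cancelʳ-< r' x (lowest w) (subst (_< lowest w + r') (cong suc (+-comm r' (k * r'))) x+r'<w+r')

    colours≤ : t ≤ lowest w + r' → t ≤ 1 + (n G / 2) * r'
    colours≤ t≤w+r' = ≮⇒≥ λ 1+qr'<t →
      <⇒≱ (n<2*[1+n/2] (n G)) (≤-trans (#lowest≤-top (n G / 2) (<-≤-trans 1+qr'<t t≤w+r')) (#lowest≤-≤n (lowest w)))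

mainTheorem14 : (G : Multigraph) (r : ℕ) → Connected G → Regular r G →
    HasIntervalColoring G →
    ∀ (t : ℕ) (α : E G → ℕ) → IsIntervalColoring G t α →
    t ≤ 1 + (n G / 2) * (r ∸ 1)
mainTheorem14 G r        _         _   _ zero    α ic = z≤n
mainTheorem14 G zero     _         reg _ (suc t) α ic = ⊥-elim (n≮0 (subst (0 <_) (reg v) (incident⇒deg>0 G {v} (inj₁ refl))))
  where
  open IsIntervalColoring ic
  v = proj₁ (ends G (proj₁ (allUsed 1 ≤-refl (s≤s z≤n))))
mainTheorem14 G (suc r') connected reg _ (suc t) α ic = colours≤ (connected u w) u≤1 t≤w+r'
  where
  open IsIntervalColoring ic
  open RegularIntervalColouring reg ic
  first = allUsed 1 ≤-refl (s≤s z≤n)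
  last  = allUsed (suc t) (s≤s z≤n) ≤-refl
  u = proj₁ (ends G (proj₁ first))
  w = proj₁ (ends G (proj₁ last))
  u≤1 : lowest u ≤ 1
  u≤1 = subst (lowest u ≤_) (proj₂ first) (lowest≤ (inj₁ refl))
  t≤w+r' : suc t ≤ lowest w + r'
  t≤w+r' = subst (_≤ lowest w + r') (proj₂ last) (≤lowest+r' (inj₁ refl))
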